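{- Let $\mathbf{L}\in\{\mathbf{K_n},\mathbf{KD_n},\mathbf{KT_n}\}$. Whenever a sequent $\Gamma\Rightarrow\Delta$ of $\mathcal{L}^2$-formulas is derivable in $\mathsf{G}(\mathbf{L}^2)$, then for every propositional variable $p$ and every $\mathcal{L}^2$-formula $B$, the sequent $\Gamma[p/B]\Rightarrow\Delta[p/B]$ is also derivable in $\mathsf{G}(\mathbf{L}^2)$.
   Context: Formulas of $\mathcal{L}^2$ over a finite agent set and countable $\mathsf{Prop}$: $A::=p\mid\bot\mid A\wedge A\mid A\vee A\mid A\rightarrow A\mid\neg A\mid\Box_iA\mid\forall pA$. $A[p/B]$ is the substitution of $B$ for $p$ in $A$ (of free occurrences, avoiding capture), and $\Gamma[p/B]=\{A[p/B]:A\in\Gamma\}$. Outmost-boxed formula: $\Box_jB$; $\Box_i\Gamma=\{\Box_iA:A\in\Gamma\}$. $\mathsf{G}(\mathbf{K_n})$: initial sequents $\Gamma,p\Rightarrow p,\Delta$ and $\bot,\Gamma\Rightarrow\Delta$; logical rules $(R\wedge)$ $\Gamma\Rightarrow\Delta,A_1$ and $\Gamma\Rightarrow\Delta,A_2$ / $\Gamma\Rightarrow\Delta,A_1\wedge A_2$; $(L\wedge)$ $A_1,A_2,\Gamma\Rightarrow\Delta$ / $A_1\wedge A_2,\Gamma\Rightarrow\Delta$; $(R\vee)$ $\Gamma\Rightarrow\Delta,A_1,A_2$ / $\Gamma\Rightarrow\Delta,A_1\vee A_2$; $(L\vee)$ $A_1,\Gamma\Rightarrow\Delta$ and $A_2,\Gamma\Rightarrow\Delta$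 / $A_1\vee A_2,\Gamma\Rightarrow\Delta$; $(R\rightarrow)$ $A_1,\Gamma\Rightarrow\Delta,A_2$ / $\Gamma\Rightarrow\Delta,A_1\rightarrow A_2$; $(L\rightarrow)$ $\Gamma\Rightarrow\Delta,A_1$ and $A_2,\Gamma\Rightarrow\Delta$ / $A_1\rightarrow A_2,\Gamma\Rightarrow\Delta$; $(R\neg)$ $A,\Gamma\Rightarrow\Delta$ / $\Gamma\Rightarrow\Delta,\neg A$; $(L\neg)$ $\Gamma\Rightarrow\Delta,A$ / $\neg A,\Gamma\Rightarrow\Delta$; $(\Box_{Kn})$: from $\Gamma\Rightarrow A$ infer $\Sigma,\Box_i\Gamma\Rightarrow\Box_iA,\Omega$ (members of $\Sigma$: propositional variables, $\bot$, or $\Box_jB$ with $j\neq i$; members of $\Omega$: propositional variables, $\bot$, or outmost-boxed formulas). $\mathsf{G}(\mathbf{KD_n})$ adds $(\Box_{Dn})$: from $\Gamma\Rightarrow$ ($\Gamma\neq\emptyset$) infer $\Sigma,\Box_i\Gamma\Rightarrow\Omega$. $\mathsf{G}(\mathbf{KT_n})$ adds $(\Box_{Tn})$: from $\Box_iA,A,\Gamma\Rightarrow\Delta$ infer $\Box_iA,\Gamma\Rightarrow\Delta$. $\mathsf{G}(\mathbf{L}^2)$ is $\mathsf{G}(\mathbf{L})$ applied to $\mathcal{L}^2$-formulas, plus: initial sequents $\forall p\Box_iA\Rightarrow\Box_i\forall pA$; weakening ($\Gamma\Rightarrow\Delta$ / $A,\Gamma\Rightarrow\Delta$ and $\Gamma\Rightarrow\Delta,A$),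 contraction ($A,A,\Gamma\Rightarrow\Delta$ / $A,\Gamma\Rightarrow\Delta$ and $\Gamma\Rightarrow\Delta,A,A$ / $\Gamma\Rightarrow\Delta,A$), cut ($\Gamma\Rightarrow\Delta,C$ and $C,\Gamma'\Rightarrow\Delta'$ / $\Gamma,\Gamma'\Rightarrow\Delta,\Delta'$); $(L\forall)$: from $\Gamma,A[p/B]\Rightarrow\Delta$ infer $\Gamma,\forall pA\Rightarrow\Delta$ (any $B$); $(R\forall)$: from $\Gamma\Rightarrow A,\Delta$ infer $\Gamma\Rightarrow\forall pA,\Delta$, provided $p$ is not free in $\Gamma,\Delta$. -}

module Defs where

open import Data.Nat using (ℕ; zero; suc; _≡ᵇ_; _⊔_)
open import Data.Bool using (Bool; true; false; if_then_else_; not; _∧_)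
open import Data.Fin using (Fin)
open import Data.List using (List; []; _∷_; _++_; map; filterᵇ; foldr; concatMap)
open import Data.Bool.ListAction using (any)
open import Data.List.Membership.Propositional using (_∉_)
open import Data.List.Relation.Unary.All using (All)
open import Data.List.Relation.Binary.Permutation.Propositional using (_↭_)
open import Relation.Binary.PropositionalEquality using (_≡_)
open import Relation.Nullary using (¬_)
open import Data.Empty using (⊥)
open import Data.Unit using (⊤)

Var : Set
Var = ℕ

data Fm (n : ℕ) : Set where
  var  : Var → Fm n
  bot  : Fm n
  _∧′_ : Fm n → Fm n → Fm n
  _∨′_ : Fm n → Fm n → Fm n
  _⇒′_ : Fm n → Fm n → Fm n
  ¬′_  : Fm n → Fm n
  □    : Fin n → Fm n → Fm n
  ∀′   : Var → Fm n → Fm n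

module _ {n : ℕ} where

  fv : Fm n → List Var
  fv (var p)   = p ∷ []
  fv bot       = []
  fv (A ∧′ B)  = fv A ++ fv B
  fv (A ∨′ B)  = fv A ++ fv B
  fv (A ⇒′ B)  = fv A ++ fv B
  fv (¬′ A)    = fv A
  fv (□ i A)   = fv A
  fv (∀′ q A)  = filterᵇ (λ x → not (x ≡ᵇ q)) (fv A)

  _∈ᵇ_ : Var → List Var → Bool
  x ∈ᵇ xs = any (x ≡ᵇ_) xs

  maxL : List Var → Var
  maxL = foldr _⊔_ 0

  Subst : Set
  Subst = Var → Fm n

  _[_↦_] : Subst → Var → Var → Subst
  (σ [ q ↦ r ]) x = if x ≡ᵇ q then var r else σ x

  sub : Subst → Fm n → Fm n
  sub σ (var p)  = σ p
  sub σ bot      = bot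
  sub σ (A ∧′ B) = sub σ A ∧′ sub σ B
  sub σ (A ∨′ B) = sub σ A ∨′ sub σ B
  sub σ (A ⇒′ B) = sub σ A ⇒′ sub σ B
  sub σ (¬′ A)   = ¬′ sub σ A
  sub σ (□ i A)  = □ i (sub σ A)
  sub σ (∀′ q A) =
    if clash
      then ∀′ r (sub (σ [ q ↦ r ]) A)
      else ∀′ q (sub (σ [ q ↦ q ]) A)
    where
      xs : List Var
      xs = fv (∀′ q A)
      clash : Bool
      clash = any (λ x → q ∈ᵇ fv (σ x)) xs
      -- a variable not free in any σ x with x free in ∀q A
      r : Var
      r = suc (maxL (concatMap (λ x → fv (σ x)) xs))

  _[_/_] : Fm n → Var → Fm n → Fm n
  A [ p / B ] = sub (λ x → if x ≡ᵇ p then B else var x) A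

  _[_/_]* : List (Fm n) → Var → Fm n → List (Fm n)
  Γ [ p / B ]* = map (λ A → A [ p / B ]) Γ

  OmegaFm : Fm n → Set
  OmegaFm (var _) = ⊤
  OmegaFm bot     = ⊤
  OmegaFm (□ _ _) = ⊤
  OmegaFm _       = ⊥

  SigmaFm : Fin n → Fm n → Set
  SigmaFm i (var _) = ⊤
  SigmaFm i bot     = ⊤
  SigmaFm i (□ j _) = ¬ (j ≡ i)
  SigmaFm i _       = ⊥

data Logic : Set where
  Kn KDn KTn : Logic

-- Derivability in G(L²); sequents are pairs of lists read as multisets
-- (closure under permutation is the rule `exch`).
data _⊢_⇒_ {n : ℕ} (L : Logic) : List (Fm n) → List (Fm n) → Set where
  exch : ∀ {Γ Γ′ Δ Δ′} → Γ ↭ Γ′ → Δ ↭ Δ′ → L ⊢ Γ ⇒ Δ → L ⊢ Γ′ ⇒ Δ′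
  ax   : ∀ {Γ Δ} p → L ⊢ (var p ∷ Γ) ⇒ (var p ∷ Δ)
  botL : ∀ {Γ Δ} → L ⊢ (bot ∷ Γ) ⇒ Δ
  bf   : ∀ p i A → L ⊢ (∀′ p (□ i A) ∷ []) ⇒ (□ i (∀′ p A) ∷ [])
  R∧ : ∀ {Γ Δ A₁ A₂} → L ⊢ Γ ⇒ (A₁ ∷ Δ) → L ⊢ Γ ⇒ (A₂ ∷ Δ) → L ⊢ Γ ⇒ ((A₁ ∧′ A₂) ∷ Δ)
  L∧ : ∀ {Γ Δ A₁ A₂} → L ⊢ (A₁ ∷ A₂ ∷ Γ) ⇒ Δ → L ⊢ ((A₁ ∧′ A₂) ∷ Γ) ⇒ Δ
  R∨ : ∀ {Γ Δ A₁ A₂} → L ⊢ Γ ⇒ (A₁ ∷ A₂ ∷ Δ) → L ⊢ Γ ⇒ ((A₁ ∨′ A₂) ∷ Δ)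
  L∨ : ∀ {Γ Δ A₁ A₂} → L ⊢ (A₁ ∷ Γ) ⇒ Δ → L ⊢ (A₂ ∷ Γ) ⇒ Δ → L ⊢ ((A₁ ∨′ A₂) ∷ Γ) ⇒ Δ
  R→ : ∀ {Γ Δ A₁ A₂} → L ⊢ (A₁ ∷ Γ) ⇒ (A₂ ∷ Δ) → L ⊢ Γ ⇒ ((A₁ ⇒′ A₂) ∷ Δ)
  L→ : ∀ {Γ Δ A₁ A₂} → L ⊢ Γ ⇒ (A₁ ∷ Δ) → L ⊢ (A₂ ∷ Γ) ⇒ Δ → L ⊢ ((A₁ ⇒′ A₂) ∷ Γ) ⇒ Δ
  R¬ : ∀ {Γ Δ A} → L ⊢ (A ∷ Γ) ⇒ Δ → L ⊢ Γ ⇒ ((¬′ A) ∷ Δ)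
  L¬ : ∀ {Γ Δ A} → L ⊢ Γ ⇒ (A ∷ Δ) → L ⊢ ((¬′ A) ∷ Γ) ⇒ Δ
  boxK : ∀ {Γ A Σ Ω} i → All (SigmaFm i) Σ → All OmegaFm Ω →
         L ⊢ Γ ⇒ (A ∷ []) → L ⊢ (Σ ++ map (□ i) Γ) ⇒ (□ i A ∷ Ω)
  boxD : ∀ {Γ Σ Ω} i → L ≡ KDn → ¬ (Γ ≡ []) → All (SigmaFm i) Σ → All OmegaFm Ω →
         L ⊢ Γ ⇒ [] → L ⊢ (Σ ++ map (□ i) Γ) ⇒ Ω
  boxT : ∀ {Γ Δ A} i → L ≡ KTn →
         L ⊢ (□ i A ∷ A ∷ Γ) ⇒ Δ → L ⊢ (□ i A ∷ Γ) ⇒ Δ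
  wkL  : ∀ {Γ Δ A} → L ⊢ Γ ⇒ Δ → L ⊢ (A ∷ Γ) ⇒ Δ
  wkR  : ∀ {Γ Δ A} → L ⊢ Γ ⇒ Δ → L ⊢ Γ ⇒ (A ∷ Δ)
  ctrL : ∀ {Γ Δ A} → L ⊢ (A ∷ A ∷ Γ) ⇒ Δ → L ⊢ (A ∷ Γ) ⇒ Δ
  ctrR : ∀ {Γ Δ A} → L ⊢ Γ ⇒ (A ∷ A ∷ Δ) → L ⊢ Γ ⇒ (A ∷ Δ)
  cut  : ∀ {Γ Δ Γ′ Δ′ C} → L ⊢ Γ ⇒ (C ∷ Δ) → L ⊢ (C ∷ Γ′) ⇒ Δ′ → L ⊢ (Γ ++ Γ′) ⇒ (Δ ++ Δ′)
  L∀ : ∀ {Γ Δ p A} B → L ⊢ (A [ p / B ] ∷ Γ) ⇒ Δ → L ⊢ (∀′ p A ∷ Γ) ⇒ Δ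
  R∀ : ∀ {Γ Δ p A} → All (λ C → p ∉ fv C) Γ → All (λ C → p ∉ fv C) Δ →
       L ⊢ Γ ⇒ (A ∷ Δ) → L ⊢ Γ ⇒ (∀′ p A ∷ Δ)

{-# OPTIONS --safe #-}
module Submission where

-- With cut, a sequent Γ ⇒ Δ is interderivable with the theorem ⇒ ⋀Γ → ⋁Δ.  Since
-- that sequent has an empty context, (R∀) generalises p in it and (L∀) instantiates
-- p by B; substitution commutes with ⋀ and ⋁.  The remaining ingredient is the
-- identity sequent A ⇒ A for compound A, whose ∀ case rests on A[q/q] = A.

open import Defs
open import Data.Nat using (ℕ; _≡ᵇ_)
open import Data.Nat.Properties using (_≟_)
open import Data.Bool using (Bool; false; not; T; _∨_)
open import Data.Bool.Properties using (∨-identityʳ; if-cong)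
open import Data.Bool.ListAction using (any)
open import Data.List using (List; []; _∷_; _++_; [_]; map)
open import Data.List.Properties using (++-identityʳ)
open import Data.List.Relation.Unary.All using ([]; _∷_)
open import Data.List.Relation.Unary.Any using (here; there)
open import Data.List.Membership.Propositional using (_∈_; _∉_)
open import Data.List.Membership.Propositional.Properties using (∈-filter⁻)
open import Data.List.Relation.Binary.Permutation.Propositional
  using (_↭_; ↭-refl; ↭-sym; ↭-reflexive; swap)
open import Data.List.Relation.Binary.Permutation.Propositional.Properties
  using (shift; ++-comm)
open import Data.Product using (proj₂)
open import Function using (_∘_)
open import Relation.Binary.PropositionalEquality
  using (_≡_; refl; sym; trans; cong; cong₂; subst; _≗_; module ≡-Reasoning)
open import Relation.Nullary.Decidable using (yes; no; T?; dec-true; dec-false)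

any-≡-false : ∀ {A : Set} {f : A → Bool} xs → (∀ {x} → x ∈ xs → f x ≡ false) →
              any f xs ≡ false
any-≡-false []       _ = refl
any-≡-false (x ∷ xs) h rewrite h (here refl) = any-≡-false xs (h ∘ there)

module _ {n : ℕ} where

  -- `does (x ≟ q)` is definitionally `x ≡ᵇ q`, so `dec-true`/`dec-false` decide the
  -- Boolean tests made by `fv` and `sub`.
  bound∉fv : ∀ q (A : Fm n) → q ∉ fv (∀′ q A)
  bound∉fv q A q∈ = subst (T ∘ not) (dec-true (q ≟ q) refl)
    (proj₂ (∈-filter⁻ (λ x → T? (not (x ≡ᵇ q))) {xs = fv A} q∈))

  no-capture-by-var : ∀ {σ : Subst {n}} → σ ≗ var → ∀ q (A : Fm n) →
                      any (λ x → _∈ᵇ_ {n} q (fv (σ x))) (fv (∀′ q A)) ≡ false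
  no-capture-by-var {σ} σ≗var q A = any-≡-false (fv (∀′ q A)) q∉σ
    where
      q∉σ : ∀ {x} → x ∈ fv (∀′ q A) → _∈ᵇ_ {n} q (fv (σ x)) ≡ false
      q∉σ {x} x∈ = begin
        _∈ᵇ_ {n} q (fv (σ x)) ≡⟨ cong (λ C → _∈ᵇ_ {n} q (fv C)) (σ≗var x) ⟩
        (q ≡ᵇ x) ∨ false ≡⟨ ∨-identityʳ _ ⟩
        q ≡ᵇ x           ≡⟨ dec-false (q ≟ x) (λ { refl → bound∉fv q A x∈ }) ⟩
        false            ∎
        where open ≡-Reasoning

  ↦-self-var : ∀ {σ : Subst {n}} → σ ≗ var → ∀ q → σ [ q ↦ q ] ≗ var
  ↦-self-var σ≗var q x with x ≟ q
  ... | yes refl rewrite dec-true (x ≟ x) refl = refl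
  ... | no x≢q   rewrite dec-false (x ≟ q) x≢q = σ≗var x

  sub-var : ∀ {σ : Subst {n}} → σ ≗ var → (A : Fm n) → sub σ A ≡ A
  sub-var σ≗var (var x)  = σ≗var x
  sub-var σ≗var bot      = refl
  sub-var σ≗var (A ∧′ B) = cong₂ _∧′_ (sub-var σ≗var A) (sub-var σ≗var B)
  sub-var σ≗var (A ∨′ B) = cong₂ _∨′_ (sub-var σ≗var A) (sub-var σ≗var B)
  sub-var σ≗var (A ⇒′ B) = cong₂ _⇒′_ (sub-var σ≗var A) (sub-var σ≗var B)
  sub-var σ≗var (¬′ A)   = cong ¬′_ (sub-var σ≗var A)
  sub-var σ≗var (□ i A)  = cong (□ i) (sub-var σ≗var A)
  sub-var σ≗var (∀′ q A) =
    trans (if-cong (no-capture-by-var σ≗var q A))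
          (cong (∀′ q) (sub-var (↦-self-var σ≗var q) A))

  sub-self : ∀ q (A : Fm n) → A [ q / var q ] ≡ A
  sub-self q = sub-var (↦-self-var {σ = var} (λ _ → refl) q)

  ⋀ : List (Fm n) → Fm n
  ⋀ []      = ¬′ bot
  ⋀ (A ∷ Γ) = A ∧′ ⋀ Γ

  ⋁ : List (Fm n) → Fm n
  ⋁ []      = bot
  ⋁ (A ∷ Δ) = A ∨′ ⋁ Δ

  ⌜_⇒_⌝ : List (Fm n) → List (Fm n) → Fm n
  ⌜ Γ ⇒ Δ ⌝ = ⋀ Γ ⇒′ ⋁ Δ

  sub-⋀ : ∀ σ Γ → sub σ (⋀ Γ) ≡ ⋀ (map (sub σ) Γ)
  sub-⋀ σ []      = refl
  sub-⋀ σ (A ∷ Γ) = cong (sub σ A ∧′_) (sub-⋀ σ Γ)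

  sub-⋁ : ∀ σ Δ → sub σ (⋁ Δ) ≡ ⋁ (map (sub σ) Δ)
  sub-⋁ σ []      = refl
  sub-⋁ σ (A ∷ Δ) = cong (sub σ A ∨′_) (sub-⋁ σ Δ)

  sub-⌜⇒⌝ : ∀ σ Γ Δ → sub σ ⌜ Γ ⇒ Δ ⌝ ≡ ⌜ map (sub σ) Γ ⇒ map (sub σ) Δ ⌝
  sub-⌜⇒⌝ σ Γ Δ = cong₂ _⇒′_ (sub-⋀ σ Γ) (sub-⋁ σ Δ)

module _ {n : ℕ} {L : Logic} where

  exchL : ∀ {Γ Γ′ Δ : List (Fm n)} → Γ ↭ Γ′ → L ⊢ Γ ⇒ Δ → L ⊢ Γ′ ⇒ Δ
  exchL π = exch π (↭-refl)

  exchR : ∀ {Γ Δ Δ′ : List (Fm n)} → Δ ↭ Δ′ → L ⊢ Γ ⇒ Δ → L ⊢ Γ ⇒ Δ′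
  exchR = exch (↭-refl)

  wkL-++ : ∀ {Γ Δ} (Γ′ : List (Fm n)) → L ⊢ Γ ⇒ Δ → L ⊢ (Γ ++ Γ′) ⇒ Δ
  wkL-++ {Γ} {Δ} Γ′ d = exchL (++-comm Γ′ Γ) (wk* Γ′)
    where
      wk* : ∀ Ξ → L ⊢ (Ξ ++ Γ) ⇒ Δ
      wk* []      = d
      wk* (A ∷ Ξ) = wkL (wk* Ξ)

  wkR-++ : ∀ {Γ Δ} (Δ′ : List (Fm n)) → L ⊢ Γ ⇒ Δ → L ⊢ Γ ⇒ (Δ ++ Δ′)
  wkR-++ {Γ} {Δ} Δ′ d = exchR (++-comm Δ′ Δ) (wk* Δ′)
    where
      wk* : ∀ Ξ → L ⊢ Γ ⇒ (Ξ ++ Δ)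
      wk* []      = d
      wk* (A ∷ Ξ) = wkR (wk* Ξ)

  ⊢-refl : (A : Fm n) → L ⊢ [ A ] ⇒ [ A ]
  ⊢-refl (var p)  = ax p
  ⊢-refl bot      = botL
  ⊢-refl (A ∧′ B) = R∧ (L∧ (wkL-++ [ B ] (⊢-refl A))) (L∧ (wkL (⊢-refl B)))
  ⊢-refl (A ∨′ B) = L∨ (R∨ (wkR-++ [ B ] (⊢-refl A))) (R∨ (wkR (⊢-refl B)))
  ⊢-refl (A ⇒′ B) =
    R→ (exchL (swap _ _ (↭-refl))
         (L→ (wkR-++ [ B ] (⊢-refl A)) (wkL-++ [ A ] (⊢-refl B))))
  ⊢-refl (¬′ A)   = R¬ (exchL (swap _ _ (↭-refl)) (L¬ (⊢-refl A)))
  ⊢-refl (□ i A)  = boxK i [] [] (⊢-refl A)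
  ⊢-refl (∀′ q A) =
    R∀ (bound∉fv q A ∷ []) []
       (L∀ (var q) (subst (λ C → L ⊢ [ C ] ⇒ [ A ]) (sym (sub-self q A)) (⊢-refl A)))

  ⋀-L : ∀ Γ Π {Δ} → L ⊢ (Γ ++ Π) ⇒ Δ → L ⊢ (⋀ Γ ∷ Π) ⇒ Δ
  ⋀-L []      Π d = wkL d
  ⋀-L (A ∷ Γ) Π d =
    L∧ (exchL (swap _ _ (↭-refl))
         (⋀-L Γ (A ∷ Π) (exchL (↭-sym (shift A Γ Π)) d)))

  ⋁-R : ∀ Δ Π {Γ} → L ⊢ Γ ⇒ (Δ ++ Π) → L ⊢ Γ ⇒ (⋁ Δ ∷ Π)
  ⋁-R []      Π d = wkR d
  ⋁-R (A ∷ Δ) Π d =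
    R∨ (exchR (swap _ _ (↭-refl))
         (⋁-R Δ (A ∷ Π) (exchR (↭-sym (shift A Δ Π)) d)))

  ⋀-R : ∀ Γ → L ⊢ Γ ⇒ [ ⋀ Γ ]
  ⋀-R []      = R¬ botL
  ⋀-R (A ∷ Γ) = R∧ (wkL-++ Γ (⊢-refl A)) (wkL (⋀-R Γ))

  ⋁-L : ∀ Δ → L ⊢ [ ⋁ Δ ] ⇒ Δ
  ⋁-L []      = botL
  ⋁-L (A ∷ Δ) = L∨ (wkR-++ Δ (⊢-refl A)) (wkR (⋁-L Δ))

  ⊢-⌜⇒⌝ : ∀ {Γ Δ} → L ⊢ Γ ⇒ Δ → L ⊢ [] ⇒ [ ⌜ Γ ⇒ Δ ⌝ ]
  ⊢-⌜⇒⌝ {Γ} {Δ} d = R→ (⋀-L Γ [] (⋁-R Δ [] (exch (++-[] Γ) (++-[] Δ) d)))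
    where
      ++-[] : ∀ Ξ → Ξ ↭ Ξ ++ []
      ++-[] Ξ = ↭-reflexive (sym (++-identityʳ Ξ))

  ⌜⇒⌝-⊢ : ∀ {Γ Δ} → L ⊢ [] ⇒ [ ⌜ Γ ⇒ Δ ⌝ ] → L ⊢ Γ ⇒ Δ
  ⌜⇒⌝-⊢ {Γ} {Δ} d = cut d (L→ (wkR-++ Δ (⋀-R Γ)) (wkL-++ Γ (⋁-L Δ)))

  ⊢-sub : ∀ {A} → L ⊢ [] ⇒ [ A ] → ∀ p B → L ⊢ [] ⇒ [ A [ p / B ] ]
  ⊢-sub {A} d p B = cut (R∀ [] [] d) (L∀ B (⊢-refl (A [ p / B ])))

proposition5p1 : {n : ℕ} (L : Logic) (Γ Δ : List (Fm n)) →
    L ⊢ Γ ⇒ Δ → (p : Var) (B : Fm n) → L ⊢ (Γ [ p / B ]*) ⇒ (Δ [ p / B ]*)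
proposition5p1 L Γ Δ d p B =
  ⌜⇒⌝-⊢ (subst (λ F → L ⊢ [] ⇒ [ F ]) (sub-⌜⇒⌝ _ Γ Δ) (⊢-sub (⊢-⌜⇒⌝ d) p B))
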